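{- Let $n\ge3$ and $d\ge1$. If an automorphism $T\in\mathbb{T}_n^d$ fixes the corner $[0,\dots,0]$ and fixes each of its neighbors, then $T$ fixes every corner of the cube $n^d$.
   Context: Let $[n]=\{0,\dots,n-1\}$; the cube $n^d$ is $[n]^d$. A set of $n$ distinct points is a line if it can be ordered $(q^1,\dots,q^n)$ such that in each coordinate the sequence of values is strictly increasing, strictly decreasing or constant, with at least one coordinate non-constant; the dimension of a line is its number of non-constant coordinates. $\mathbb{T}_n^d$ is the group of permutations of $[n]^d$ mapping lines onto lines. A corner is a point with all coordinates in $\{0,n-1\}$. An edge is a line of dimension $1$ containing two corners; two corners are neighbors if some edge contains both. A point is fixed by $T$ if $T(p)=p$. -}

module Defs where

open import Data.Nat using (ℕ; suc; _∸_)
open import Data.Fin using (Fin; _<_; toℕ)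
open import Data.Vec using (Vec; lookup)
open import Data.Product using (Σ; ∃; ∃-syntax; _×_; _,_)
open import Data.Sum using (_⊎_)
open import Function.Definitions using (Injective)
open import Function.Bundles using (_↔_; Inverse)
open import Relation.Binary.PropositionalEquality using (_≡_)
open import Relation.Nullary using (¬_)
open import Level using (0ℓ)

Point : ℕ → ℕ → Set
Point n d = Vec (Fin n) d

PointSet : ℕ → ℕ → Set₁
PointSet n d = Point n d → Set

StrictlyIncreasing : ∀ {n} → (Fin n → Fin n) → Set
StrictlyIncreasing f = ∀ i j → i < j → f i < f j

StrictlyDecreasing : ∀ {n} → (Fin n → Fin n) → Set
StrictlyDecreasing f = ∀ i j → i < j → f j < f i

Constant : ∀ {n} → (Fin n → Fin n) → Set
Constant f = ∀ i j → f i ≡ f j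

Enumerates : ∀ {n d} → PointSet n d → (Fin n → Point n d) → Set
Enumerates S q = Injective _≡_ _≡_ q × (∀ p → S p → ∃[ i ] q i ≡ p) × (∀ i → S (q i))

coord : ∀ {n d} → (Fin n → Point n d) → Fin d → Fin n → Fin n
coord q k i = lookup (q i) k

IsLineOrdering : ∀ {n d} → (Fin n → Point n d) → Set
IsLineOrdering q =
  (∀ k → StrictlyIncreasing (coord q k) ⊎ StrictlyDecreasing (coord q k) ⊎ Constant (coord q k))
  × (∃[ k ] ¬ Constant (coord q k))

IsLine : ∀ {n d} → PointSet n d → Set
IsLine {n} {d} S = ∃[ q ] (Enumerates S q × IsLineOrdering q)

-- S is a line of dimension 1: some ordering witnessing the line has exactly one
-- non-constant coordinate.  (The number of non-constant coordinates does not
-- depend on the ordering chosen, as the only orderings are q and its reverse.)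
IsLine₁ : ∀ {n d} → PointSet n d → Set
IsLine₁ {n} {d} S =
  ∃[ q ] (Enumerates S q × IsLineOrdering q
          × ∃[ k ] (¬ Constant (coord q k) × (∀ k' → ¬ Constant (coord q k') → k' ≡ k)))

image : ∀ {n d} → (Point n d → Point n d) → PointSet n d → PointSet n d
image T S p = ∃[ x ] (S x × T x ≡ p)

record Automorphism (n d : ℕ) : Set₁ where
  field
    perm      : Point n d ↔ Point n d
  open Inverse perm public using (to; from)
  field
    linesTo   : ∀ (S : PointSet n d) → IsLine S → IsLine (image to S)
    linesOnto : ∀ (L : PointSet n d) → IsLine L
                → Σ (PointSet n d) (λ S → IsLine S × (∀ p → L p → image to S p) × (∀ p → image to S p → L p))

IsCorner : ∀ {n d} → Point n d → Set
IsCorner {n} {d} p = ∀ k → toℕ (lookup p k) ≡ 0 ⊎ toℕ (lookup p k) ≡ n ∸ 1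

IsEdge : ∀ {n d} → PointSet n d → Set
IsEdge {n} {d} S =
  IsLine₁ S × ∃[ c ] ∃[ c' ] (¬ c ≡ c' × IsCorner c × IsCorner c' × S c × S c')

Neighbors : ∀ {n d} → Point n d → Point n d → Set₁
Neighbors {n} {d} c c' =
  IsCorner c × IsCorner c' × ¬ c ≡ c' × Σ (PointSet n d) (λ S → IsEdge S × S c × S c')

IsOrigin : ∀ {n d} → Point n d → Set
IsOrigin p = ∀ k → toℕ (lookup p k) ≡ 0

module Submission where

-- Key observation (level-sets-closed): for a line-preserving injection G, if
-- two points of a line have images with the same coordinate z, all points of
-- the line do, since along the image line coordinate z is constant or
-- injective.  Generation lemma (generate, via plane-fill): for n ≥ 3, a set
-- closed under lines through two of its points and containing the origin and
-- the e_a with a ∈ A contains every point supported in A (induction on the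
-- number of nonzero coordinates).  Together they show that T and T⁻¹ map each
-- facet {x_z = 0} into itself (preserves-facets).  For a corner c with
-- c_a = n-1, the line from e_a to c keeps coordinate a at n-1, and so does its
-- image: otherwise the image would meet the facet x_a = 0, which T⁻¹ forbids
-- (keeps-top).  Hence T c = c coordinatewise, and lemma4 follows.

open import Defs
open import Data.Nat using (ℕ; _≤_)
open import Relation.Binary.PropositionalEquality using (_≡_)

import Data.Nat as ℕ
import Data.Nat.Properties as ℕP
open import Data.Nat.Induction using (<-wellFounded)
open import Data.Fin as F using (Fin; zero; suc; toℕ; opposite; punchOut)
import Data.Fin.Properties as FP
open import Data.Vec using (Vec; []; _∷_; lookup; replicate; map; _[_]≔_)
open import Data.Vec.Properties
  using (lookup∘updateAt; lookup∘updateAt′; []≔-commutes; []≔-lookup; lookup-replicate; lookup-map;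
         tabulate∘lookup; tabulate-cong)
open import Data.Product using (∃-syntax; _×_; _,_; proj₁; proj₂)
open import Data.Sum using (_⊎_; inj₁; inj₂)
open import Data.Empty using (⊥-elim)
open import Function.Bundles using (Inverse)
open import Function.Definitions using (Injective)
open import Induction.WellFounded using (module All)
import Relation.Binary.Construct.On as On
open import Relation.Binary.Definitions using (tri<; tri≈; tri>)
open import Relation.Binary.PropositionalEquality
  using (refl; sym; trans; cong; subst; subst₂; _≢_; module ≡-Reasoning)
open import Relation.Nullary using (¬_; yes; no; contradiction)
open import Relation.Nullary.Decidable using (¬?; _×-dec_; decidable-stable)
open import Level using (0ℓ)

Shape : ∀ {n} → (Fin n → Fin n) → Set
Shape f = StrictlyIncreasing f ⊎ StrictlyDecreasing f ⊎ Constant f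

shape-resp : ∀ {n} {f g : Fin n → Fin n} → (∀ i → f i ≡ g i) → Shape g → Shape f
shape-resp e (inj₁ inc) = inj₁ (λ i j i<j → subst₂ F._<_ (sym (e i)) (sym (e j)) (inc i j i<j))
shape-resp e (inj₂ (inj₁ dec)) = inj₂ (inj₁ (λ i j i<j → subst₂ F._<_ (sym (e j)) (sym (e i)) (dec i j i<j)))
shape-resp e (inj₂ (inj₂ c)) = inj₂ (inj₂ (λ i j → trans (e i) (trans (c i j) (sym (e j)))))

identity-shape : ∀ {n} → Shape {n} (λ i → i)
identity-shape = inj₁ (λ _ _ i<j → i<j)

constant-shape : ∀ {n} (x : Fin n) → Shape (λ (_ : Fin n) → x)
constant-shape x = inj₂ (inj₂ (λ _ _ → refl))

opposite-shape : ∀ {n} → Shape (opposite {n})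
opposite-shape = inj₂ (inj₁ decreasing)
  where
    decreasing : StrictlyDecreasing opposite
    decreasing i j i<j =
      subst₂ ℕ._<_ (sym (FP.opposite-prop j)) (sym (FP.opposite-prop i))
        (ℕP.∸-monoʳ-< (ℕ.s≤s i<j) (FP.toℕ<n j))

separated⇒injective : ∀ {n} {f : Fin n → Fin n} → (∀ {i j} → i F.< j → f i ≢ f j)
                      → Injective _≡_ _≡_ f
separated⇒injective sep {i} {j} e with FP.<-cmp i j
... | tri< i<j _ _ = contradiction e (sep i<j)
... | tri≈ _ i≡j _ = i≡j
... | tri> _ _ j<i = contradiction (sym e) (sep j<i)

shape-dichotomy : ∀ {n} {f : Fin n → Fin n} → Shape f → Constant f ⊎ Injective _≡_ _≡_ f
shape-dichotomy (inj₁ inc) = inj₂ (separated⇒injective (λ i<j e → FP.<-irrefl e (inc _ _ i<j)))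
shape-dichotomy (inj₂ (inj₁ dec)) = inj₂ (separated⇒injective (λ i<j e → FP.<-irrefl (sym e) (dec _ _ i<j)))
shape-dichotomy (inj₂ (inj₂ c)) = inj₁ c

injective⇒surjective : ∀ {n} {f : Fin n → Fin n} → Injective _≡_ _≡_ f → ∀ y → ∃[ j ] f j ≡ y
injective⇒surjective {ℕ.suc k} {f} f-inj y with FP.any? (λ j → f j FP.≟ y)
... | yes hit = hit
... | no miss =
  let (i , j , i<j , collision) = FP.pigeonhole (ℕP.n<1+n k) (λ j → punchOut (avoids j))
  in ⊥-elim (FP.<⇒≢ i<j (f-inj (FP.punchOut-injective (avoids i) (avoids j) collision)))
  where
    avoids : ∀ j → y ≢ f j
    avoids j e = miss (j , sym e)

vec-ext : ∀ {A : Set} {k} {v w : Vec A k} → (∀ i → lookup v i ≡ lookup w i) → v ≡ w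
vec-ext {v = v} {w} h = trans (sym (tabulate∘lookup v)) (trans (tabulate-cong h) (tabulate∘lookup w))

-- Equality in Fin is decidable, so a coordinate that is not nonzero is zero.
not-nonzero : ∀ {n} {x : Fin (ℕ.suc n)} → ¬ (x ≢ zero) → x ≡ zero
not-nonzero {x = x} = decidable-stable (x FP.≟ zero)

nonzero : ∀ {n} → Fin n → ℕ
nonzero zero = 0
nonzero (suc _) = 1

-- The number of nonzero coordinates; the measure for the generation induction.
weight : ∀ {n k} → Vec (Fin n) k → ℕ
weight [] = 0
weight (x ∷ v) = nonzero x ℕ.+ weight v

_⊑_ : ∀ {n k} → Vec (Fin (ℕ.suc n)) k → Vec (Fin (ℕ.suc n)) k → Set
p ⊑ q = ∀ z → lookup q z ≡ zero → lookup p z ≡ zero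

nonzero-mono : ∀ {n} (x y : Fin (ℕ.suc n)) → (y ≡ zero → x ≡ zero) → nonzero x ≤ nonzero y
nonzero-mono zero y _ = ℕ.z≤n
nonzero-mono (suc x) zero h = contradiction (h refl) (λ ())
nonzero-mono (suc x) (suc y) _ = ℕP.≤-refl

weight-mono : ∀ {n k} (p q : Vec (Fin (ℕ.suc n)) k) → p ⊑ q → weight p ≤ weight q
weight-mono [] [] _ = ℕ.z≤n
weight-mono (x ∷ p) (y ∷ q) p⊑q =
  ℕP.+-mono-≤ (nonzero-mono x y (p⊑q zero)) (weight-mono p q (λ z → p⊑q (suc z)))

weight-strict : ∀ {n k} (p q : Vec (Fin (ℕ.suc n)) k) → p ⊑ q
                → ∀ a → lookup p a ≡ zero → lookup q a ≢ zero → weight p ℕ.< weight q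
weight-strict (x ∷ p) (zero ∷ q) _ zero _ q₀≢0 = contradiction refl q₀≢0
weight-strict (zero ∷ p) (suc y ∷ q) p⊑q zero _ _ = ℕ.s≤s (weight-mono p q (λ z → p⊑q (suc z)))
weight-strict (x ∷ p) (y ∷ q) p⊑q (suc a) pa qa =
  ℕP.+-mono-≤-< (nonzero-mono x y (p⊑q zero)) (weight-strict p q (λ z → p⊑q (suc z)) a pa qa)

module _ {n d : ℕ} where
  -- The points of a line ordering are distinct: some coordinate is strictly monotone.
  ordering-injective : ∀ {q : Fin n → Point n d} → IsLineOrdering q → Injective _≡_ _≡_ q
  ordering-injective (shapes , k , k-moves) e with shape-dichotomy (shapes k)
  ... | inj₁ constant = contradiction constant k-moves
  ... | inj₂ k-injective = k-injective (cong (λ p → lookup p k) e)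

  range : (Fin n → Point n d) → PointSet n d
  range q p = ∃[ i ] q i ≡ p

  range-enumerated : ∀ {q} → IsLineOrdering q → Enumerates (range q) q
  range-enumerated lo = ordering-injective lo , (λ p r → r) , (λ i → i , refl)

  range-isLine : ∀ {q} → IsLineOrdering q → IsLine (range q)
  range-isLine {q} lo = q , range-enumerated lo , lo

  MapsLinesIntoLines : (Point n d → Point n d) → Set
  MapsLinesIntoLines G =
    ∀ q → IsLineOrdering q → ∃[ q' ] (IsLineOrdering q' × (∀ i → ∃[ j ] q' j ≡ G (q i)))

  LineClosed : PointSet n d → Set
  LineClosed S = ∀ q → IsLineOrdering q → ∀ {j k} → j ≢ k → S (q j) → S (q k) → ∀ i → S (q i)

  level-sets-closed : ∀ {G} → MapsLinesIntoLines G → Injective _≡_ _≡_ G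
                      → ∀ z w → LineClosed (λ p → lookup (G p) z ≡ w)
  level-sets-closed {G} maps G-inj z w q lo {j} {k} j≢k Gj Gk i with maps q lo
  ... | q' , lo' , covers = begin
      lookup (G (q i)) z             ≡⟨ cong (λ p → lookup p z) (sym (proj₂ (covers i))) ⟩
      coord q' z (proj₁ (covers i))  ≡⟨ constant _ _ ⟩
      coord q' z (proj₁ (covers j))  ≡⟨ value-at j Gj ⟩
      w                              ∎
    where
      open ≡-Reasoning
      value-at : ∀ l → lookup (G (q l)) z ≡ w → coord q' z (proj₁ (covers l)) ≡ w
      value-at l e = trans (cong (λ p → lookup p z) (proj₂ (covers l))) e
      distinct : proj₁ (covers j) ≢ proj₁ (covers k)
      distinct e = j≢k (ordering-injective lo (G-inj
        (trans (sym (proj₂ (covers j))) (trans (cong q' e) (proj₂ (covers k))))))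
      constant : Constant (coord q' z)
      constant with shape-dichotomy (proj₁ lo' z)
      ... | inj₁ c = c
      ... | inj₂ z-injective = contradiction (z-injective (trans (value-at j Gj) (sym (value-at k Gk)))) distinct

module _ {n d : ℕ} (T : Automorphism n d) where
  open Automorphism T

  from∘to : ∀ p → from (to p) ≡ p
  from∘to = Inverse.strictlyInverseʳ perm

  to-injective : Injective _≡_ _≡_ to
  to-injective {x} {y} e = trans (sym (from∘to x)) (trans (cong from e) (from∘to y))

  from-injective : Injective _≡_ _≡_ from
  from-injective {x} {y} e =
    trans (sym (Inverse.strictlyInverseˡ perm x)) (trans (cong to e) (Inverse.strictlyInverseˡ perm y))

  fixed-by-from : ∀ {p} → to p ≡ p → from p ≡ p
  fixed-by-from {p} e = trans (cong from (sym e)) (from∘to p)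

  to-image : ∀ q → IsLineOrdering q
             → ∃[ q' ] (IsLineOrdering q' × (∀ i → ∃[ j ] q' j ≡ to (q i)) × (∀ j → ∃[ i ] q' j ≡ to (q i)))
  to-image q lo with linesTo (range q) (range-isLine lo)
  ... | q' , (_ , covered , members) , lo' = q' , lo' , covers , onto
    where
      covers : ∀ i → ∃[ j ] q' j ≡ to (q i)
      covers i = covered (to (q i)) (q i , (i , refl) , refl)
      onto : ∀ j → ∃[ i ] q' j ≡ to (q i)
      onto j with members j
      ... | x , (i , qi≡x) , tx≡q'j = i , trans (sym tx≡q'j) (cong to (sym qi≡x))

  to-maps-lines : MapsLinesIntoLines to
  to-maps-lines q lo with to-image q lo
  ... | q' , lo' , covers , _ = q' , lo' , covers

  -- T⁻¹ maps lines into lines, since every line is the T-image of a line.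
  from-maps-lines : MapsLinesIntoLines from
  from-maps-lines q lo with linesOnto (range q) (range-isLine lo)
  ... | S , (q'' , (_ , covered , _) , lo'') , into-image , _ = q'' , lo'' , covers
    where
      covers : ∀ i → ∃[ j ] q'' j ≡ from (q i)
      covers i with into-image (q i) (i , refl)
      ... | x , Sx , tx≡qi with covered x Sx
      ...   | j , q''j≡x = j , trans q''j≡x (trans (sym (from∘to x)) (cong from tx≡qi))

-- From here on n = m + 3: filling a coordinate plane needs three values.
module Cube (m d : ℕ) where
  n : ℕ
  n = 3 ℕ.+ m

  Pt : Set
  Pt = Point n d

  top one : Fin n
  top = opposite zero
  one = suc zero

  zero≢top : zero ≢ top
  zero≢top ()

  origin : Pt
  origin = replicate d zero

  unitCorner : Fin d → Pt
  unitCorner a = origin [ a ]≔ top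

  corner-values : ∀ (c : Pt) → IsCorner c → ∀ z → lookup c z ≡ zero ⊎ lookup c z ≡ top
  corner-values c cc z with cc z
  ... | inj₁ e = inj₁ (FP.toℕ-injective e)
  ... | inj₂ e = inj₂ (FP.toℕ-injective (trans e (sym (FP.toℕ-fromℕ (2 ℕ.+ m)))))

  moving : ∀ (q : Fin n → Pt) z → (∀ i → coord q z i ≡ i) → ¬ Constant (coord q z)
  moving q z e c = zero≢top (trans (sym (e zero)) (trans (c zero top) (e top)))

  axisLine : Pt → Fin d → Fin n → Pt
  axisLine p a i = p [ a ]≔ i

  axisLine-on : ∀ p a i → lookup (axisLine p a i) a ≡ i
  axisLine-on p a i = lookup∘updateAt a p

  axisLine-off : ∀ p {a z} → z ≢ a → Constant (coord (axisLine p a) z)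
  axisLine-off p {a} {z} z≢a i j = trans (lookup∘updateAt′ z a z≢a p) (sym (lookup∘updateAt′ z a z≢a p))

  axisLine-ordering : ∀ p a → IsLineOrdering (axisLine p a)
  axisLine-ordering p a = shapes , a , moving (axisLine p a) a (axisLine-on p a)
    where
      shapes : ∀ z → Shape (coord (axisLine p a) z)
      shapes z with z FP.≟ a
      ... | yes refl = shape-resp (axisLine-on p a) identity-shape
      ... | no z≢a = inj₂ (inj₂ (axisLine-off p z≢a))

  plane : Pt → Fin d → Fin d → Fin n → Fin n → Pt
  plane p a b s t = (p [ a ]≔ s) [ b ]≔ t

  plane-a : ∀ p {a b} s t → a ≢ b → lookup (plane p a b s t) a ≡ s
  plane-a p {a} {b} s t a≢b = trans (lookup∘updateAt′ a b a≢b (p [ a ]≔ s)) (lookup∘updateAt a p)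

  plane-b : ∀ p {a b} s t → lookup (plane p a b s t) b ≡ t
  plane-b p {a} {b} s t = lookup∘updateAt b (p [ a ]≔ s)

  plane-off : ∀ p {a b z} s t → z ≢ a → z ≢ b → lookup (plane p a b s t) z ≡ lookup p z
  plane-off p {a} {b} {z} s t z≢a z≢b =
    trans (lookup∘updateAt′ z b z≢b (p [ a ]≔ s)) (lookup∘updateAt′ z a z≢a p)

  antiDiagonal : Pt → Fin d → Fin d → Fin n → Pt
  antiDiagonal p a b i = plane p a b i (opposite i)

  antiDiagonal-ordering : ∀ p {a b} → a ≢ b → IsLineOrdering (antiDiagonal p a b)
  antiDiagonal-ordering p {a} {b} a≢b = shapes , a , moving (antiDiagonal p a b) a (λ i → plane-a p i (opposite i) a≢b)
    where
      shapes : ∀ z → Shape (coord (antiDiagonal p a b) z)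
      shapes z with z FP.≟ b | z FP.≟ a
      ... | yes refl | _ = shape-resp (λ i → plane-b p i (opposite i)) opposite-shape
      ... | no _ | yes refl = shape-resp (λ i → plane-a p i (opposite i) a≢b) identity-shape
      ... | no z≢b | no z≢a =
        shape-resp (λ i → plane-off p i (opposite i) z≢a z≢b) (constant-shape (lookup p z))

  -- Corner paths: from the unit corner e_a to a corner c with c_a = n-1,
  -- raising the other nonzero coordinates of c together.
  raise : Fin n → Fin n → Fin n
  raise i zero = zero
  raise i (suc _) = i

  raise-shape : ∀ x → Shape (λ i → raise i x)
  raise-shape zero = constant-shape zero
  raise-shape (suc _) = identity-shape

  raise-nonzero : ∀ {x} i → x ≢ zero → raise i x ≡ i
  raise-nonzero {zero} i x≢0 = contradiction refl x≢0
  raise-nonzero {suc _} i _ = refl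

  raise-top : ∀ {x} → x ≡ zero ⊎ x ≡ top → raise top x ≡ x
  raise-top (inj₁ refl) = refl
  raise-top (inj₂ refl) = refl

  raise-zero : ∀ {k} (v : Vec (Fin n) k) → map (raise zero) v ≡ replicate k zero
  raise-zero [] = refl
  raise-zero (zero ∷ v) = cong (zero ∷_) (raise-zero v)
  raise-zero (suc _ ∷ v) = cong (zero ∷_) (raise-zero v)

  cornerPath : Pt → Fin d → Fin n → Pt
  cornerPath c a i = map (raise i) c [ a ]≔ top

  cornerPath-at : ∀ c a i → lookup (cornerPath c a i) a ≡ top
  cornerPath-at c a i = lookup∘updateAt a (map (raise i) c)

  cornerPath-off : ∀ c {a z} i → z ≢ a → lookup (cornerPath c a i) z ≡ raise i (lookup c z)
  cornerPath-off c {a} {z} i z≢a = trans (lookup∘updateAt′ z a z≢a (map (raise i) c)) (lookup-map z (raise i) c)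

  cornerPath-ordering : ∀ c {a w} → w ≢ a → lookup c w ≢ zero → IsLineOrdering (cornerPath c a)
  cornerPath-ordering c {a} {w} w≢a cw≢0 =
    shapes , w , moving (cornerPath c a) w (λ i → trans (cornerPath-off c i w≢a) (raise-nonzero i cw≢0))
    where
      shapes : ∀ z → Shape (coord (cornerPath c a) z)
      shapes z with z FP.≟ a
      ... | yes refl = shape-resp (cornerPath-at c a) (constant-shape top)
      ... | no z≢a = shape-resp (λ i → cornerPath-off c i z≢a) (raise-shape (lookup c z))

  cornerPath-start : ∀ c a → cornerPath c a zero ≡ unitCorner a
  cornerPath-start c a = cong (_[ a ]≔ top) (raise-zero c)

  cornerPath-end : ∀ {c} → IsCorner c → ∀ a → lookup c a ≡ top → cornerPath c a top ≡ c
  cornerPath-end {c} cc a ca≡top = begin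
    map (raise top) c [ a ]≔ top       ≡⟨ cong (_[ a ]≔ top) (vec-ext raise-corner) ⟩
    c [ a ]≔ top                       ≡⟨ cong (c [ a ]≔_) (sym ca≡top) ⟩
    c [ a ]≔ lookup c a                ≡⟨ []≔-lookup c a ⟩
    c                                  ∎
    where
      open ≡-Reasoning
      raise-corner : ∀ z → lookup (map (raise top) c) z ≡ lookup c z
      raise-corner z = trans (lookup-map z (raise top) c) (raise-top (corner-values c cc z))

  all-zero : ∀ {p : Pt} → (∀ z → lookup p z ≡ zero) → p ≡ origin
  all-zero h = vec-ext (λ z → trans (h z) (sym (lookup-replicate z zero)))

  origin-update-zero : ∀ a → origin [ a ]≔ zero ≡ origin
  origin-update-zero a = trans (cong (origin [ a ]≔_) (sym (lookup-replicate a zero))) ([]≔-lookup origin a)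

  other-nonzero : ∀ (p : Pt) a → ∃[ b ] (b ≢ a × lookup p b ≢ zero) ⊎ p ≡ origin [ a ]≔ lookup p a
  other-nonzero p a with FP.any? (λ b → ¬? (b FP.≟ a) ×-dec ¬? (lookup p b FP.≟ zero))
  ... | yes found = inj₁ found
  ... | no none = inj₂ (vec-ext coordinate)
    where
      coordinate : ∀ z → lookup p z ≡ lookup (origin [ a ]≔ lookup p a) z
      coordinate z with z FP.≟ a
      ... | yes refl = sym (lookup∘updateAt a origin)
      ... | no z≢a = trans (not-nonzero (λ nz → none (z , z≢a , nz)))
                           (sym (trans (lookup∘updateAt′ z a z≢a origin) (lookup-replicate z zero)))

  axis-fill : ∀ (S : PointSet n d) → LineClosed S → S origin → ∀ a → S (unitCorner a) → ∀ i → S (origin [ a ]≔ i)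
  axis-fill S closed S-origin a S-unit =
    closed (axisLine origin a) (axisLine-ordering origin a) zero≢top (subst S (sym (origin-update-zero a)) S-origin) S-unit

  -- A coordinate plane is filled by a line-closed set containing its two axes;
  -- this uses the anti-diagonal, the row t = 1 and the columns (needs n ≥ 3).
  plane-fill : ∀ (S : PointSet n d) → LineClosed S → ∀ p {a b} → a ≢ b
               → (∀ t → S (plane p a b zero t)) → (∀ s → S (plane p a b s zero))
               → ∀ s t → S (plane p a b s t)
  plane-fill S closed p {a} {b} a≢b b-axis a-axis s t =
    closed (axisLine (p [ a ]≔ s) b) (axisLine-ordering (p [ a ]≔ s) b) (λ ()) (a-axis s) (row-one s) t
    where
      -- The anti-diagonal joins (0, n-1) and (n-1, 0).
      anti : ∀ i → S (antiDiagonal p a b i)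
      anti = closed (antiDiagonal p a b) (antiDiagonal-ordering p a≢b) zero≢top
        (b-axis top) (subst (λ t → S (plane p a b top t)) (sym (FP.opposite-involutive zero)) (a-axis top))
      row-as-axisLine : ∀ s → plane p a b s one ≡ axisLine (p [ b ]≔ one) a s
      row-as-axisLine s = []≔-commutes p a b a≢b
      -- The row t = 1 joins (0, 1) and (n-2, 1), which lies on the anti-diagonal.
      row-one : ∀ s → S (plane p a b s one)
      row-one s = subst S (sym (row-as-axisLine s))
        (closed (axisLine (p [ b ]≔ one) a) (axisLine-ordering (p [ b ]≔ one) a) {zero} {opposite one} (λ ())
          (subst S (row-as-axisLine zero) (b-axis one))
          (subst S (row-as-axisLine (opposite one))
            (subst (λ t → S (plane p a b (opposite one) t)) (FP.opposite-involutive one) (anti (opposite one))))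
          s)

  -- By induction on the weight: a point
  -- with two nonzero coordinates a, b lies in the (a,b)-plane whose axes
  -- consist of lighter points.
  generate : ∀ (S : PointSet n d) → LineClosed S → (A : Fin d → Set)
             → S origin → (∀ a → A a → S (unitCorner a))
             → ∀ p → (∀ a → lookup p a ≢ zero → A a) → S p
  generate S closed A S-origin S-unit = All.wfRec (On.wellFounded weight <-wellFounded) 0ℓ Goal step
    where
      Goal : Pt → Set
      Goal p = (∀ a → lookup p a ≢ zero → A a) → S p

      step : ∀ p → (∀ {p'} → weight p' ℕ.< weight p → Goal p') → Goal p
      step p ih in-A with FP.any? (λ a → ¬? (lookup p a FP.≟ zero))
      ... | no none = subst S (sym (all-zero (λ z → not-nonzero (λ nz → none (z , nz))))) S-origin
      ... | yes (a , pa≢0) with other-nonzero p a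
      ...   | inj₂ p-on-axis =
        subst S (sym p-on-axis) (axis-fill S closed S-origin a (S-unit a (in-A a pa≢0)) (lookup p a))
      ...   | inj₁ (b , b≢a , pb≢0) =
        subst S plane-self
          (plane-fill S closed p a≢b (λ t → smaller (plane-a p zero t a≢b) pa≢0)
                                    (λ s → smaller (plane-b p s zero) pb≢0)
                      (lookup p a) (lookup p b))
        where
          a≢b : a ≢ b
          a≢b e = b≢a (sym e)
          plane-self : plane p a b (lookup p a) (lookup p b) ≡ p
          plane-self = trans (cong (_[ b ]≔ lookup p b) ([]≔-lookup p a)) ([]≔-lookup p b)
          plane-⊑ : ∀ {s t} → plane p a b s t ⊑ p
          plane-⊑ z pz = trans (plane-off p _ _ (λ { refl → pa≢0 pz }) (λ { refl → pb≢0 pz })) pz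
          smaller : ∀ {s t c} → lookup (plane p a b s t) c ≡ zero → lookup p c ≢ zero → S (plane p a b s t)
          smaller {s} {t} {c} x0 p≢0 =
            ih (weight-strict (plane p a b s t) p plane-⊑ c x0 p≢0) (λ z xz≢0 → in-A z (λ pz → xz≢0 (plane-⊑ z pz)))

  preserves-facets : ∀ {G} → MapsLinesIntoLines G → Injective _≡_ _≡_ G
                     → G origin ≡ origin → (∀ a → G (unitCorner a) ≡ unitCorner a)
                     → ∀ p z → lookup p z ≡ zero → lookup (G p) z ≡ zero
  preserves-facets {G} maps G-inj G-origin G-unit p z pz =
    generate (λ p → lookup (G p) z ≡ zero) (level-sets-closed maps G-inj z zero) (_≢ z) origin-in unit-in p support
    where
      origin-in : lookup (G origin) z ≡ zero
      origin-in = trans (cong (λ v → lookup v z) G-origin) (lookup-replicate z zero)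
      unit-in : ∀ a → a ≢ z → lookup (G (unitCorner a)) z ≡ zero
      unit-in a a≢z = trans (cong (λ v → lookup v z) (G-unit a))
        (trans (lookup∘updateAt′ z a (λ e → a≢z (sym e)) origin) (lookup-replicate z zero))
      support : ∀ a → lookup p a ≢ zero → a ≢ z
      support a pa≢0 refl = pa≢0 pz

  module _ (T : Automorphism n d) (T-origin : Automorphism.to T origin ≡ origin)
           (T-unit : ∀ a → Automorphism.to T (unitCorner a) ≡ unitCorner a) where
    open Automorphism T

    -- T⁻¹ also preserves the facets, so T cannot move a point into a facet.
    reflects-facets : ∀ p z → lookup (to p) z ≡ zero → lookup p z ≡ zero
    reflects-facets p z e =
      subst (λ v → lookup v z ≡ zero) (from∘to T p)
        (preserves-facets (from-maps-lines T) (from-injective T) (fixed-by-from T T-origin)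
          (λ a → fixed-by-from T (T-unit a)) (to p) z e)

    -- A line avoiding the facet x_a = 0 has an image along which coordinate a
    -- is constant: an injective coordinate would take the value 0, but only
    -- images of points of the facet have coordinate a equal to 0.
    avoiding-facet : ∀ q → IsLineOrdering q → ∀ a → (∀ i → lookup (q i) a ≢ zero)
                     → ∀ i j → lookup (to (q i)) a ≡ lookup (to (q j)) a
    avoiding-facet q lo a avoids i j with to-image T q lo
    ... | q' , lo' , covers , onto with shape-dichotomy (proj₁ lo' a)
    ...   | inj₁ constant = trans (image-at i) (trans (constant _ _) (sym (image-at j)))
      where
        image-at : ∀ l → lookup (to (q l)) a ≡ coord q' a (proj₁ (covers l))
        image-at l = cong (λ v → lookup v a) (sym (proj₂ (covers l)))
    ...   | inj₂ a-injective with injective⇒surjective a-injective zero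
    ...     | k , q'k-zero with onto k
    ...       | l , q'k≡to-ql =
      contradiction (reflects-facets (q l) a (trans (cong (λ v → lookup v a) (sym q'k≡to-ql)) q'k-zero)) (avoids l)

    unitCorner-keeps-top : ∀ a → lookup (to (unitCorner a)) a ≡ top
    unitCorner-keeps-top a = trans (cong (λ v → lookup v a) (T-unit a)) (lookup∘updateAt a origin)

    -- Coordinates equal to n-1 in a corner are kept by T: compare c with e_a
    -- along the corner path, which avoids the facet x_a = 0.
    keeps-top : ∀ c → IsCorner c → ∀ a → lookup c a ≡ top → lookup (to c) a ≡ top
    keeps-top c cc a ca≡top with other-nonzero c a
    ... | inj₂ c-on-axis =
      subst (λ v → lookup (to v) a ≡ top) (sym (trans c-on-axis (cong (origin [ a ]≔_) ca≡top))) (unitCorner-keeps-top a)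
    ... | inj₁ (w , w≢a , cw≢0) = begin
      lookup (to c) a                     ≡⟨ cong (λ v → lookup (to v) a) (sym (cornerPath-end cc a ca≡top)) ⟩
      lookup (to (cornerPath c a top)) a  ≡⟨ avoiding-facet (cornerPath c a) (cornerPath-ordering c w≢a cw≢0) a
                                               (λ i e → zero≢top (trans (sym e) (cornerPath-at c a i))) top zero ⟩
      lookup (to (cornerPath c a zero)) a ≡⟨ cong (λ v → lookup (to v) a) (cornerPath-start c a) ⟩
      lookup (to (unitCorner a)) a        ≡⟨ unitCorner-keeps-top a ⟩
      top                                 ∎
      where open ≡-Reasoning

    corners-fixed : ∀ c → IsCorner c → to c ≡ c
    corners-fixed c cc = vec-ext coordinate
      where
        coordinate : ∀ z → lookup (to c) z ≡ lookup c z
        coordinate z with corner-values c cc z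
        ... | inj₁ e = trans (preserves-facets (to-maps-lines T) (to-injective T) T-origin T-unit c z e) (sym e)
        ... | inj₂ e = trans (keeps-top c cc z e) (sym e)

  unitCorner-neighbour : ∀ a → Neighbors origin (unitCorner a)
  unitCorner-neighbour a =
    origin-corner , unit-corner , distinct , range (axisLine origin a) ,
      (edge-line , origin , unitCorner a , distinct , origin-corner , unit-corner , starts , ends) ,
      starts , ends
    where
      unit-at-a : lookup (unitCorner a) a ≡ top
      unit-at-a = lookup∘updateAt a origin
      unit-off-a : ∀ {z} → z ≢ a → lookup (unitCorner a) z ≡ zero
      unit-off-a {z} z≢a = trans (lookup∘updateAt′ z a z≢a origin) (lookup-replicate z zero)
      origin-corner : IsCorner origin
      origin-corner z = inj₁ (cong toℕ (lookup-replicate z zero))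
      unit-corner : IsCorner (unitCorner a)
      unit-corner z with z FP.≟ a
      ... | yes refl = inj₂ (trans (cong toℕ unit-at-a) (FP.toℕ-fromℕ (2 ℕ.+ m)))
      ... | no z≢a = inj₁ (cong toℕ (unit-off-a z≢a))
      distinct : origin ≢ unitCorner a
      distinct e = zero≢top (trans (sym (lookup-replicate a zero)) (trans (cong (λ v → lookup v a) e) unit-at-a))
      starts : range (axisLine origin a) origin
      starts = zero , origin-update-zero a
      ends : range (axisLine origin a) (unitCorner a)
      ends = top , refl
      only-a-moves : ∀ k → ¬ Constant (coord (axisLine origin a) k) → k ≡ a
      only-a-moves k moves with k FP.≟ a
      ... | yes k≡a = k≡a
      ... | no k≢a = contradiction (axisLine-off origin k≢a) moves
      edge-line : IsLine₁ (range (axisLine origin a))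
      edge-line = axisLine origin a , range-enumerated (axisLine-ordering origin a) , axisLine-ordering origin a ,
                  a , moving (axisLine origin a) a (axisLine-on origin a) , only-a-moves

lemma4 : (n d : ℕ) → 3 ≤ n → 1 ≤ d → (T : Automorphism n d)
         → (o : Point n d) → IsOrigin o
         → Automorphism.to T o ≡ o
         → (∀ c → Neighbors o c → Automorphism.to T c ≡ c)
         → ∀ c → IsCorner c → Automorphism.to T c ≡ c
lemma4 (ℕ.suc (ℕ.suc (ℕ.suc m))) d (ℕ.s≤s (ℕ.s≤s (ℕ.s≤s ℕ.z≤n))) _ T o o-origin T-o T-neighbours =
  corners-fixed T T-origin T-unit
  where
    open Cube m d
    o≡origin : o ≡ origin
    o≡origin = all-zero (λ z → FP.toℕ-injective (o-origin z))
    T-origin : Automorphism.to T origin ≡ origin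
    T-origin = subst (λ x → Automorphism.to T x ≡ x) o≡origin T-o
    T-unit : ∀ a → Automorphism.to T (unitCorner a) ≡ unitCorner a
    T-unit a = T-neighbours (unitCorner a) (subst (λ x → Neighbors x (unitCorner a)) (sym o≡origin) (unitCorner-neighbour a))
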